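{- The class of proper interval graphs is strictly contained in the class of exactly hittable interval graphs, which is strictly contained in the class of interval graphs.
   Context: An interval representation of a graph $G=(V,E)$ is a family of intervals of consecutive integers $\{I(v)\}_{v\in V}$ with $uv\in E$ iff $I(u)\cap I(v)\ne\emptyset$ for distinct $u,v$; $G$ is an interval graph if it has one. $G$ is a proper interval graph if it has an interval representation in which no interval is properly contained in another. An interval graph is exactly hittable if it has an interval representation $\{I(v)\}$ admitting a set $T$ of integers with $|T\cap I(v)|=1$ for every $v$. -}

module Defs where

open import Data.Nat using (ℕ)
open import Data.Fin using (Fin)
open import Data.Integer using (ℤ; _≤_)
open import Data.Product using (Σ; ∃; _×_; _,_)
open import Relation.Nullary using (¬_)
open import Relation.Binary.PropositionalEquality using (_≡_)

record Graph : Set₁ where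
  field
    n     : ℕ
    Adj   : Fin n → Fin n → Set
    sym   : ∀ {u v} → Adj u v → Adj v u
    irrefl : ∀ {u} → ¬ Adj u u
open Graph public

record Interval : Set where
  constructor [_,_∣_]
  field
    lo : ℤ
    hi : ℤ
    lo≤hi : lo ≤ hi
open Interval public

_∈I_ : ℤ → Interval → Set
x ∈I I = (lo I ≤ x) × (x ≤ hi I)

Meets : Interval → Interval → Set
Meets I J = ∃ λ x → (x ∈I I) × (x ∈I J)

_⊆I_ : Interval → Interval → Set
I ⊆I J = ∀ x → x ∈I I → x ∈I J

_⊂I_ : Interval → Interval → Set
I ⊂I J = (I ⊆I J) × ¬ (J ⊆I I)

IsIntervalRep : (G : Graph) → (Fin (n G) → Interval) → Set
IsIntervalRep G I =
  ∀ u v → ¬ (u ≡ v) → (Adj G u v → Meets (I u) (I v)) × (Meets (I u) (I v) → Adj G u v)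

IsIntervalGraph : Graph → Set
IsIntervalGraph G = Σ (Fin (n G) → Interval) λ I → IsIntervalRep G I

IsProperIntervalGraph : Graph → Set
IsProperIntervalGraph G = Σ (Fin (n G) → Interval) λ I →
  IsIntervalRep G I × (∀ u v → ¬ (I u ⊂I I v))

HitsExactlyOnce : (ℤ → Set) → Interval → Set
HitsExactlyOnce T I = ∃ λ x → (x ∈I I) × T x × (∀ y → y ∈I I → T y → y ≡ x)

IsExactlyHittable : Graph → Set₁
IsExactlyHittable G = Σ (Fin (n G) → Interval) λ I →
  IsIntervalRep G I × (Σ (ℤ → Set) λ T → ∀ v → HitsExactlyOnce T (I v))

-- Greedy hitting: the least right end m hits every interval starting at or before m, and we
-- recurse on the intervals starting after m.  Every later point is the right end of such an
-- interval J, so an interval I ∋ m containing it would properly contain J.  In an interval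
-- model of the claw K₁,₃ a leaf containing neither end of the centre lies properly inside it,
-- and two pairwise disjoint leaves cannot share an end, so three leaves force a nesting.
-- In K₁,₄ each leaf is pierced by an end of the centre or by the unique hitting point of the
-- centre, and three points cannot pierce four disjoint leaves.
module Submission where

open import Defs
open import Data.Product using (Σ; _×_)
open import Relation.Nullary using (¬_)

open import Data.Empty using (⊥; ⊥-elim)
open import Data.Fin using (Fin; zero; suc)
open import Data.Fin.Properties using (suc-injective; pigeonhole; all?; _≟_)
import Data.Fin.Properties as Fin
open import Data.Integer using (ℤ; +_; _≤_; _<_; _⊔_)
open import Data.Integer.Properties
  using (≤-refl; ≤-trans; <⇒≤; <⇒≱; ≰⇒>; ≮⇒≥; ≤-<-trans; _≤?_; _<?_; i≤i⊔j; i≤j⊔i; ⊔-lub; ≤-totalOrder)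
open import Data.List using (List; []; _∷_; length; filter; tabulate)
open import Data.List.Extrema ≤-totalOrder using (argmin; argmin-sel; f[argmin]≤f[⊤]; f[argmin]≤f[xs])
open import Data.List.Membership.Propositional using (_∈_)
open import Data.List.Membership.Propositional.Properties using (∈-filter⁺; ∈-filter⁻; ∈-tabulate⁺; ∈-tabulate⁻)
open import Data.List.Properties using (filter-notAll)
open import Data.List.Relation.Unary.All as All using ()
open import Data.List.Relation.Unary.Any as Any using (here; there)
open import Data.Nat as ℕ using (ℕ; zero; suc; s≤s)
import Data.Nat.Properties as ℕ
open import Data.Product using (∃; _,_; proj₁; proj₂)
open import Data.Sum using (_⊎_; inj₁; inj₂)
open import Data.Unit using (⊤; tt)
open import Data.Vec using (Vec; []; _∷_; lookup)
open import Function using (_∘_)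
open import Relation.Binary.PropositionalEquality using (_≡_; _≢_; refl; subst) renaming (sym to ≡-sym)
open import Relation.Nullary using (Dec; yes; no)
open import Relation.Nullary.Decidable using (True; toWitness; from-yes; map′; ¬?; _×-dec_; _→-dec_)
open import Relation.Unary using (Decidable)

Meets⇒lo≤hi : ∀ {I J} → Meets I J → lo I ≤ hi J × lo J ≤ hi I
Meets⇒lo≤hi (x , (lo≤x , x≤hi) , (lo′≤x , x≤hi′)) = ≤-trans lo≤x x≤hi′ , ≤-trans lo′≤x x≤hi

meets? : ∀ I J → Dec (Meets I J)
meets? I J = map′ common (Meets⇒lo≤hi {I} {J}) (lo I ≤? hi J ×-dec lo J ≤? hi I)
  where
  common : lo I ≤ hi J × lo J ≤ hi I → Meets I J
  common (loI≤hiJ , loJ≤hiI) =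
    lo I ⊔ lo J , (i≤i⊔j _ _ , ⊔-lub (lo≤hi I) loJ≤hiI) , (i≤j⊔i _ _ , ⊔-lub loI≤hiJ (lo≤hi J))

_∈I?_ : ∀ x I → Dec (x ∈I I)
x ∈I? I = lo I ≤? x ×-dec x ≤? hi I

⊂I-fromBounds : ∀ {I J} → lo J < lo I → hi I ≤ hi J → I ⊂I J
⊂I-fromBounds {I} {J} loJ<loI hiI≤hiJ = I⊆J , J⊈I
  where
  I⊆J : I ⊆I J
  I⊆J x (loI≤x , x≤hiI) = ≤-trans (<⇒≤ loJ<loI) loI≤x , ≤-trans x≤hiI hiI≤hiJ
  J⊈I : ¬ J ⊆I I
  J⊈I J⊆I = <⇒≱ loJ<loI (proj₁ (J⊆I (lo J) (≤-refl , lo≤hi J)))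

meets∧lo≤lo⇒lo∈I : ∀ {I J} → Meets I J → lo I ≤ lo J → lo J ∈I I
meets∧lo≤lo⇒lo∈I {I} {J} I∩J loI≤loJ = loI≤loJ , proj₂ (Meets⇒lo≤hi {I} {J} I∩J)

meets∧hi≤hi⇒hi∈I : ∀ {I J} → Meets I J → hi J ≤ hi I → hi J ∈I I
meets∧hi≤hi⇒hi∈I {I} {J} I∩J hiJ≤hiI = proj₁ (Meets⇒lo≤hi {I} {J} I∩J) , hiJ≤hiI

pairwiseDisjoint-pierced⇒≤ : ∀ {m n} (I : Fin n → Interval) →
  (∀ i j → i ≢ j → ¬ Meets (I i) (I j)) →
  (p : Fin m → ℤ) → (∀ i → ∃ λ c → p c ∈I I i) → n ℕ.≤ m
pairwiseDisjoint-pierced⇒≤ {m} {n} I disjoint p pierce = ℕ.≮⇒≥ m≮n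
  where
  m≮n : ¬ m ℕ.< n
  m≮n m<n with pigeonhole m<n (λ i → proj₁ (pierce i))
  ... | i , j , i<j , same =
    disjoint i j (Fin.<⇒≢ i<j) (_ , subst (λ c → p c ∈I I i) same (proj₂ (pierce i)) , proj₂ (pierce j))

ProperFamily : List Interval → Set
ProperFamily F = ∀ {I J} → I ∈ F → J ∈ F → ¬ I ⊂I J

record ExactHitting (F : List Interval) : Set₁ where
  field
    points          : ℤ → Set
    hitsOnce        : ∀ {I} → I ∈ F → HitsExactlyOnce points I
    points⇒rightEnd : ∀ {t} → points t → ∃ λ I → I ∈ F × hi I ≡ t
open ExactHitting

exactHitting-[] : ExactHitting []
exactHitting-[] = record { points = λ _ → ⊥ ; hitsOnce = λ () ; points⇒rightEnd = λ () }

module GreedyStep (I₀ : Interval) (F₀ : List Interval) where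

  F : List Interval
  F = I₀ ∷ F₀

  first : Interval
  first = argmin hi I₀ F₀

  m : ℤ
  m = hi first

  first∈F : first ∈ F
  first∈F with argmin-sel hi I₀ F₀
  ... | inj₁ first≡I₀ = here first≡I₀
  ... | inj₂ first∈F₀ = there first∈F₀

  m≤hi : ∀ {I} → I ∈ F → m ≤ hi I
  m≤hi (here refl) = f[argmin]≤f[⊤] {f = hi} I₀ F₀
  m≤hi (there I∈F₀) = All.lookup (f[argmin]≤f[xs] {f = hi} I₀ F₀) I∈F₀

  late? : Decidable (λ I → m < lo I)
  late? I = m <? lo I

  late : List Interval
  late = filter late? F

  late⊆F : ∀ {I} → I ∈ late → I ∈ F
  late⊆F I∈late = proj₁ (∈-filter⁻ late? I∈late)

  late⇒m<lo : ∀ {I} → I ∈ late → m < lo I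
  late⇒m<lo I∈late = proj₂ (∈-filter⁻ late? I∈late)

  first-notLate : ¬ m < lo first
  first-notLate m<lo = <⇒≱ m<lo (lo≤hi first)

  late-shorter : length late ℕ.< length F
  late-shorter = filter-notAll late? F (Any.map (λ { refl → first-notLate }) first∈F)

  module _ (proper : ProperFamily F) (H : ExactHitting late) where

    T : ℤ → Set
    T x = x ≡ m ⊎ points H x

    T⇒rightEnd : ∀ {t} → T t → ∃ λ I → I ∈ F × hi I ≡ t
    T⇒rightEnd (inj₁ refl) = first , first∈F , refl
    T⇒rightEnd (inj₂ t∈H) with points⇒rightEnd H t∈H
    ... | J , J∈late , hiJ≡t = J , late⊆F J∈late , hiJ≡t

    hitsLate : ∀ {I} → I ∈ late → HitsExactlyOnce T I
    hitsLate {I} I∈late with hitsOnce H I∈late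
    ... | x , x∈I , x∈H , unique = x , x∈I , inj₂ x∈H , unique′
      where
      unique′ : ∀ y → y ∈I I → T y → y ≡ x
      unique′ y (lo≤y , _) (inj₁ refl) = ⊥-elim (<⇒≱ (late⇒m<lo I∈late) lo≤y)
      unique′ y y∈I (inj₂ y∈H) = unique y y∈I y∈H

    hitsEarly : ∀ {I} → I ∈ F → lo I ≤ m → HitsExactlyOnce T I
    hitsEarly {I} I∈F lo≤m = m , (lo≤m , m≤hi I∈F) , inj₁ refl , unique
      where
      unique : ∀ y → y ∈I I → T y → y ≡ m
      unique y _ (inj₁ y≡m) = y≡m
      unique y (_ , y≤hi) (inj₂ y∈H) with points⇒rightEnd H y∈H
      ... | J , J∈late , refl =
        ⊥-elim (proper (late⊆F J∈late) I∈F (⊂I-fromBounds {J} {I} (≤-<-trans lo≤m (late⇒m<lo J∈late)) y≤hi))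

    extend : ExactHitting F
    extend = record { points = T ; hitsOnce = hits ; points⇒rightEnd = T⇒rightEnd }
      where
      hits : ∀ {I} → I ∈ F → HitsExactlyOnce T I
      hits {I} I∈F with m <? lo I
      ... | yes m<lo = hitsLate (∈-filter⁺ late? I∈F m<lo)
      ... | no m≮lo = hitsEarly I∈F (≮⇒≥ m≮lo)

proper⇒exactHitting : ∀ F → ProperFamily F → ExactHitting F
proper⇒exactHitting F = go (length F) F ℕ.≤-refl
  where
  go : ∀ k F → length F ℕ.≤ k → ProperFamily F → ExactHitting F
  go _ [] _ _ = exactHitting-[]
  go (suc k) (I₀ ∷ F₀) (s≤s |F₀|≤k) proper =
    extend proper (go k late (ℕ.≤-trans (ℕ.≤-pred late-shorter) |F₀|≤k) (λ I∈ J∈ → proper (late⊆F I∈) (late⊆F J∈)))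
    where open GreedyStep I₀ F₀

proper⇒exactlyHittable : ∀ G → IsProperIntervalGraph G → IsExactlyHittable G
proper⇒exactlyHittable G (I , rep , noNesting) = I , rep , points H , λ v → hitsOnce H (∈-tabulate⁺ v)
  where
  proper : ProperFamily (tabulate I)
  proper J∈ K∈ with ∈-tabulate⁻ J∈ | ∈-tabulate⁻ K∈
  ... | u , refl | v , refl = noNesting u v
  H : ExactHitting (tabulate I)
  H = proper⇒exactHitting (tabulate I) proper

exactlyHittable⇒interval : ∀ G → IsExactlyHittable G → IsIntervalGraph G
exactlyHittable⇒interval G (I , rep , _) = I , rep

StarAdj : ∀ {k} → Fin k → Fin k → Set
StarAdj zero    zero    = ⊥
StarAdj zero    (suc _) = ⊤
StarAdj (suc _) zero    = ⊤
StarAdj (suc _) (suc _) = ⊥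

StarAdj-sym : ∀ {k} {u v : Fin k} → StarAdj u v → StarAdj v u
StarAdj-sym {u = zero}  {suc _} tt = tt
StarAdj-sym {u = suc _} {zero}  tt = tt

StarAdj-irrefl : ∀ {k} {u : Fin k} → ¬ StarAdj u u
StarAdj-irrefl {u = zero}  ()
StarAdj-irrefl {u = suc _} ()

starAdj? : ∀ {k} (u v : Fin k) → Dec (StarAdj u v)
starAdj? zero    zero    = no λ ()
starAdj? zero    (suc _) = yes tt
starAdj? (suc _) zero    = yes tt
starAdj? (suc _) (suc _) = no λ ()

Star : ℕ → Graph
Star k = record { n = suc k ; Adj = StarAdj ; sym = StarAdj-sym ; irrefl = StarAdj-irrefl }

module StarRep {k} {I : Fin (suc k) → Interval} (rep : IsIntervalRep (Star k) I) where

  centre : Interval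
  centre = I zero

  leaf : Fin k → Interval
  leaf i = I (suc i)

  leaf-meets-centre : ∀ i → Meets (leaf i) centre
  leaf-meets-centre i = proj₁ (rep (suc i) zero λ ()) tt

  leaves-disjoint : ∀ i j → i ≢ j → ¬ Meets (leaf i) (leaf j)
  leaves-disjoint i j i≢j = proj₂ (rep (suc i) (suc j) (i≢j ∘ suc-injective))

star-notProper : ∀ k → ¬ IsProperIntervalGraph (Star (3 ℕ.+ k))
star-notProper k (I , rep , noNesting) =
  ℕ.<⇒≱ (ℕ.m≤m+n 3 k) (pairwiseDisjoint-pierced⇒≤ leaf leaves-disjoint (lookup ends) pierce)
  where
  open StarRep {3 ℕ.+ k} {I} rep
  ends : Vec ℤ 2
  ends = lo centre ∷ hi centre ∷ []
  pierce : ∀ i → ∃ λ c → lookup ends c ∈I leaf i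
  pierce i with lo (leaf i) ≤? lo centre | hi centre ≤? hi (leaf i)
  ... | yes lo≤lo | _        = zero , meets∧lo≤lo⇒lo∈I {leaf i} {centre} (leaf-meets-centre i) lo≤lo
  ... | no _      | yes hi≤hi = suc zero , meets∧hi≤hi⇒hi∈I {leaf i} {centre} (leaf-meets-centre i) hi≤hi
  ... | no lo≰lo  | no hi≰hi  =
    ⊥-elim (noNesting (suc i) zero (⊂I-fromBounds {leaf i} {centre} (≰⇒> lo≰lo) (<⇒≤ (≰⇒> hi≰hi))))

star-notExactlyHittable : ∀ k → ¬ IsExactlyHittable (Star (4 ℕ.+ k))
star-notExactlyHittable k (I , rep , T , hits) with hits zero
... | t , _ , _ , onlyT =
  ℕ.<⇒≱ (ℕ.m≤m+n 4 k) (pairwiseDisjoint-pierced⇒≤ leaf leaves-disjoint (lookup piercing) pierce)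
  where
  open StarRep {4 ℕ.+ k} {I} rep
  piercing : Vec ℤ 3
  piercing = lo centre ∷ t ∷ hi centre ∷ []
  pierce : ∀ i → ∃ λ c → lookup piercing c ∈I leaf i
  pierce i with hits (suc i)
  ... | x , x∈leaf@(lo≤x , x≤hi) , x∈T , _ with lo centre ≤? x | x ≤? hi centre
  ... | no lo≰x | _ =
    zero , meets∧lo≤lo⇒lo∈I {leaf i} {centre} (leaf-meets-centre i) (≤-trans lo≤x (<⇒≤ (≰⇒> lo≰x)))
  ... | yes _ | no x≰hi =
    suc (suc zero) , meets∧hi≤hi⇒hi∈I {leaf i} {centre} (leaf-meets-centre i) (≤-trans (<⇒≤ (≰⇒> x≰hi)) x≤hi)
  ... | yes lo≤x′ | yes x≤hi′ = suc zero , subst (_∈I leaf i) (onlyT x (lo≤x′ , x≤hi′) x∈T) x∈leaf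

⟦_,_⟧ : (a b : ℤ) → {True (a ≤? b)} → Interval
⟦ a , b ⟧ {a≤b} = [ a , b ∣ toWitness a≤b ]

isIntervalRep? : ∀ G → (∀ u v → Dec (Adj G u v)) → ∀ I → Dec (IsIntervalRep G I)
isIntervalRep? G adj? I = all? λ u → all? λ v →
  ¬? (u ≟ v) →-dec ((adj? u v →-dec meets? (I u) (I v)) ×-dec (meets? (I u) (I v) →-dec adj? u v))

hitsExactlyOnce-filter : ∀ ts I {x} → filter (_∈I? I) ts ≡ x ∷ [] → HitsExactlyOnce (_∈ ts) I
hitsExactlyOnce-filter ts I {x} only-x = x , proj₂ x∈ts∩I , proj₁ x∈ts∩I , unique
  where
  x∈ts∩I : x ∈ ts × x ∈I I
  x∈ts∩I = ∈-filter⁻ (_∈I? I) (subst (x ∈_) (≡-sym only-x) (here refl))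
  unique : ∀ y → y ∈I I → y ∈ ts → y ≡ x
  unique y y∈I y∈ts with subst (y ∈_) only-x (∈-filter⁺ (_∈I? I) y∈ts y∈I)
  ... | here y≡x = y≡x

clawModel : Fin 4 → Interval
clawModel zero                   = ⟦ + 1 , + 5 ⟧
clawModel (suc zero)             = ⟦ + 0 , + 1 ⟧
clawModel (suc (suc zero))       = ⟦ + 3 , + 3 ⟧
clawModel (suc (suc (suc zero))) = ⟦ + 5 , + 6 ⟧

clawHitting : List ℤ
clawHitting = + 0 ∷ + 3 ∷ + 6 ∷ []

claw-exactlyHittable : IsExactlyHittable (Star 3)
claw-exactlyHittable =
  clawModel , from-yes (isIntervalRep? (Star 3) starAdj? clawModel) , (_∈ clawHitting) , hits
  where
  hits : ∀ v → HitsExactlyOnce (_∈ clawHitting) (clawModel v)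
  hits zero                   = hitsExactlyOnce-filter clawHitting (clawModel zero) refl
  hits (suc zero)             = hitsExactlyOnce-filter clawHitting (clawModel (suc zero)) refl
  hits (suc (suc zero))       = hitsExactlyOnce-filter clawHitting (clawModel (suc (suc zero))) refl
  hits (suc (suc (suc zero))) = hitsExactlyOnce-filter clawHitting (clawModel (suc (suc (suc zero)))) refl

star₄Model : Fin 5 → Interval
star₄Model zero                         = ⟦ + 0 , + 8 ⟧
star₄Model (suc zero)                   = ⟦ + 1 , + 1 ⟧
star₄Model (suc (suc zero))             = ⟦ + 3 , + 3 ⟧
star₄Model (suc (suc (suc zero)))       = ⟦ + 5 , + 5 ⟧
star₄Model (suc (suc (suc (suc zero)))) = ⟦ + 7 , + 7 ⟧

star₄-interval : IsIntervalGraph (Star 4)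
star₄-interval = star₄Model , from-yes (isIntervalRep? (Star 4) starAdj? star₄Model)

theorem3 : ((G : Graph) → IsProperIntervalGraph G → IsExactlyHittable G)
         × (Σ Graph λ G → IsExactlyHittable G × ¬ IsProperIntervalGraph G)
         × ((G : Graph) → IsExactlyHittable G → IsIntervalGraph G)
         × (Σ Graph λ G → IsIntervalGraph G × ¬ IsExactlyHittable G)
theorem3 = proper⇒exactlyHittable
         , (Star 3 , claw-exactlyHittable , star-notProper 0)
         , exactlyHittable⇒interval
         , (Star 4 , star₄-interval , star-notExactlyHittable 0)
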